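{- Let $P$ be a parallelogram polyomino with lower leftmost cell $S$ and upper rightmost cell $E$, and let $h(P)$ and $v(P)$ be its horizontal and vertical greedy paths. Then the numbers of changes of direction of $h(P)$ and of $v(P)$ differ by at most one.
   Context: A polyomino is a finite edge-connected union of unit cells of $\mathbb{Z}^2$; a parallelogram polyomino is one whose boundary consists of two north/east lattice paths with common endpoints, otherwise disjoint. An internal path is a sequence of distinct cells with consecutive cells edge-adjacent; consecutive cells give a north or east step (for the paths considered here); a side is a maximal run of equal steps and a change of direction is a pair of consecutive steps of different types. The horizontal path $h(P)$ is the internal path from $S$ to $E$ that starts with an east step and in which every side has maximal length (it goes east as long as the next cell east belongs to $P$, then north as long as possible, and so on); the vertical path $v(P)$ is defined the same way but starting with a north step. If $S$ has no cell of $P$ directly above it (the first column has one cell), $v(P)$ is defined to coincide with $h(P)$; if $S$ has no cell of $P$ directly to its right (the first row has one cell), $h(P)$ is defined to coincide with $v(P)$. -}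

module Defs where

open import Data.Nat using (ℕ; zero; suc; _+_; _<ᵇ_; _≤ᵇ_)
open import Data.Bool using (Bool; true; false; if_then_else_; _∧_)
open import Data.List using (List; []; _∷_; length)
open import Data.Product using (_×_; _,_; ∃)
open import Data.Maybe using (Maybe; just; nothing)
open import Data.List.Membership.Propositional using (_∈_)
open import Relation.Nullary using (¬_)
open import Relation.Binary.PropositionalEquality using (_≡_)

data Step : Set where
  N E : Step

Path : Set
Path = List Step

countN : Path → ℕ
countN []       = 0
countN (N ∷ p)  = suc (countN p)
countN (E ∷ p)  = countN p

countE : Path → ℕ
countE []       = 0
countE (E ∷ p)  = suc (countE p)
countE (N ∷ p)  = countE p

Point : Set
Point = ℕ × ℕ

move : Step → Point → Point
move N (x , y) = (x , suc y)
move E (x , y) = (suc x , y)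

-- Vertices of a path started at a point, excluding the first and the last vertex.
innerPts : Point → Path → List Point
innerPts q []            = []
innerPts q (s ∷ [])      = []
innerPts q (s ∷ t ∷ ps)  = move s q ∷ innerPts (move s q) (t ∷ ps)

-- A parallelogram polyomino, presented by its upper boundary path U and lower
-- boundary path L (both from the origin): they have the same endpoints and are
-- otherwise disjoint.
record IsParallelogram (U L : Path) : Set where
  field
    upperStart : ∃ λ p → U ≡ N ∷ p
    lowerStart : ∃ λ p → L ≡ E ∷ p
    sameN      : countN U ≡ countN L
    sameE      : countE U ≡ countE L
    disjoint   : ∀ (q : Point) → q ∈ innerPts (0 , 0) U → ¬ (q ∈ innerPts (0 , 0) L)

-- Height of the east step of a path (started at (x , y)) that goes from
-- abscissa c to c + 1, if any.
eastHeight : Point → Path → ℕ → Maybe ℕ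
eastHeight q       []       c = nothing
eastHeight (x , y) (N ∷ p)  c = eastHeight (x , suc y) p c
eastHeight (x , y) (E ∷ p)  c = if x Data.Nat.≡ᵇ c then just y else eastHeight (suc x , y) p c

-- Cell (x , y) is the unit square [x, x+1] × [y, y+1]; it lies in the region
-- iff in column x the lower path's east step is at height ≤ y and the upper
-- path's east step is at height > y.
inP : Path → Path → ℕ → ℕ → Bool
inP U L x y with eastHeight (0 , 0) L x | eastHeight (0 , 0) U x
... | just b | just t = (b ≤ᵇ y) ∧ (y <ᵇ t)
... | _      | _      = false

greedy : (ℕ → ℕ → Bool) → ℕ → Step → ℕ → ℕ → List Step
greedy mem zero    d x y = []
greedy mem (suc k) E x y =
  if mem (suc x) y then E ∷ greedy mem k E (suc x) y
  else (if mem x (suc y) then N ∷ greedy mem k N x (suc y) else [])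
greedy mem (suc k) N x y =
  if mem x (suc y) then N ∷ greedy mem k N x (suc y)
  else (if mem (suc x) y then E ∷ greedy mem k E (suc x) y else [])

-- The lower leftmost cell S of the polyomino is the cell (0 , 0); every internal
-- path from S to E has countE U + countN U - 2 steps, so this much fuel suffices.
-- h(P): starts with an east step (if the first row has a single cell, the greedy
-- procedure starts north, so h(P) coincides with v(P), as in the convention).
hPath : Path → Path → List Step
hPath U L = greedy (inP U L) (countE U + countN U) E 0 0

vPath : Path → Path → List Step
vPath U L = greedy (inP U L) (countE U + countN U) N 0 0

sameStep : Step → Step → Bool
sameStep N N = true
sameStep E E = true
sameStep _ _ = false

changes : List Step → ℕ
changes []            = 0
changes (s ∷ [])      = 0
changes (s ∷ t ∷ ps)  = (if sameStep s t then 0 else 1) + changes (t ∷ ps)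

-- A parallelogram polyomino is a staircase of columns 0 .. w - 1: column x consists of the
-- heights in [bottom x , top x), both bounds weakly increase with x, and consecutive columns
-- overlap (bottom (x + 1) < top x). The argument about greedy paths only uses this structure,
-- so it is carried out for an arbitrary staircase (module Staircase); the module Columns then
-- extracts the staircase from the boundary paths U and L, the overlap being exactly where their
-- disjointness is used (via the lemmas on inner vertices of lattice paths proved first).
--
-- Write T(c) for the number of turns of the east-greedy path from a cell c. Key lemma
-- (turns-compare): if c = (x , y) and c' = (x' , y') with y ≤ y' lie in rows meeting a common
-- column, then T(c') ≤ T(c) ≤ T(c') + 2. Indeed the path from c runs to the end of its row,
-- climbs that column and turns east into a cell (c₁ , y₁) with y' ≤ y₁ after two turns, and
-- the claim follows by induction with the roles of the two cells exchanged. Finally v(P) climbs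
-- column 0 and turns east into (1 , y₁), so it has 1 + T(1 , y₁) turns while h(P) has T(0 , 0),
-- and the key lemma for (0 , 0) and (1 , y₁) shows that these differ by at most one.

module Submission where

open import Defs
open import Data.Nat using (ℕ; zero; suc; _+_; _∸_; _≤_; _<_; z≤n; s≤s; s≤s⁻¹; _≟_; _≤?_; _<?_; _≡ᵇ_)
open import Data.Nat.Properties
open import Data.Bool using (Bool; true; false; T; if_then_else_)
open import Data.Bool.Properties using (T-≡; T-∧)
open import Data.List using (List; []; _∷_)
open import Data.Product using (_×_; _,_; ∃; Σ; proj₁; proj₂)
open import Data.Sum using (inj₁; inj₂)
open import Data.Maybe using (just; nothing; fromMaybe)
open import Data.Maybe.Properties using (just-injective)
open import Data.Empty using (⊥-elim)
open import Function.Bundles using (Equivalence)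
open import Relation.Nullary using (¬_; yes; no)
open import Relation.Binary.PropositionalEquality using (_≡_; _≢_; refl; sym; trans; cong; subst; subst₂)
open import Data.List.Membership.Propositional using (_∈_)
open import Data.List.Relation.Unary.Any using (here; there)

≡true⇒T : ∀ {b} → b ≡ true → T b
≡true⇒T = Equivalence.from T-≡

T⇒≡true : ∀ {b} → T b → b ≡ true
T⇒≡true = Equivalence.to T-≡

eastHeight-here : ∀ x y p → eastHeight (x , y) (E ∷ p) x ≡ just y
eastHeight-here x y p rewrite T⇒≡true (≡⇒≡ᵇ x x refl) = refl

eastHeight-skip : ∀ {x c} y p → x ≢ c → eastHeight (x , y) (E ∷ p) c ≡ eastHeight (suc x , y) p c
eastHeight-skip {x} {c} y p x≢c with x ≡ᵇ c in eq
... | true  = ⊥-elim (x≢c (≡ᵇ⇒≡ x c (≡true⇒T eq)))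
... | false = refl

eastHeight-column : ∀ p x y {c a} → eastHeight (x , y) p c ≡ just a → x ≤ c × c < x + countE p
eastHeight-column []      x y ()
eastHeight-column (N ∷ p) x y e = eastHeight-column p x (suc y) e
eastHeight-column (E ∷ p) x y {c} e with x ≟ c
... | yes refl = ≤-refl , m<m+n x (s≤s z≤n)
... | no x≢c   with eastHeight-column p (suc x) y (trans (sym (eastHeight-skip y p x≢c)) e)
...   | x<c , c<end = <⇒≤ x<c , subst (c <_) (sym (+-suc x (countE p))) c<end

eastHeight-defined : ∀ p x y c → x ≤ c → c < x + countE p → ∃ λ a → eastHeight (x , y) p c ≡ just a
eastHeight-defined []      x y c x≤c c<end = ⊥-elim (<⇒≱ (subst (c <_) (+-identityʳ x) c<end) x≤c)
eastHeight-defined (N ∷ p) x y c x≤c c<end = eastHeight-defined p x (suc y) c x≤c c<end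
eastHeight-defined (E ∷ p) x y c x≤c c<end with x ≟ c
... | yes refl = y , eastHeight-here x y p
... | no x≢c   with eastHeight-defined p (suc x) y c (≤∧≢⇒< x≤c x≢c) (subst (c <_) (+-suc x (countE p)) c<end)
...   | a , e = a , trans (eastHeight-skip y p x≢c) e

eastHeight-height : ∀ p x y {c a} → eastHeight (x , y) p c ≡ just a → y ≤ a × a ≤ y + countN p
eastHeight-height []      x y ()
eastHeight-height (N ∷ p) x y e with eastHeight-height p x (suc y) e
... | y<a , a≤end = <⇒≤ y<a , subst (_≤_ _) (sym (+-suc y (countN p))) a≤end
eastHeight-height (E ∷ p) x y {c} e with x ≟ c
... | yes refl with just-injective (trans (sym (eastHeight-here x y p)) e)
...   | refl = ≤-refl , m≤m+n y (countN p)
eastHeight-height (E ∷ p) x y e | no x≢c = eastHeight-height p (suc x) y (trans (sym (eastHeight-skip y p x≢c)) e)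

eastHeight-monotone : ∀ p x y {c c' a a'} → eastHeight (x , y) p c ≡ just a → eastHeight (x , y) p c' ≡ just a' →
  c ≤ c' → a ≤ a'
eastHeight-monotone []      x y () _ _
eastHeight-monotone (N ∷ p) x y e e' c≤c' = eastHeight-monotone p x (suc y) e e' c≤c'
eastHeight-monotone (E ∷ p) x y {c} e e' c≤c' with x ≟ c
... | yes refl with just-injective (trans (sym (eastHeight-here x y p)) e)
...   | refl = proj₁ (eastHeight-height (E ∷ p) x y e')
eastHeight-monotone (E ∷ p) x y e e' c≤c' | no x≢c =
  eastHeight-monotone p (suc x) y (trans (sym (eastHeight-skip y p x≢c)) e)
                                  (trans (sym (eastHeight-skip y p x≢c')) e') c≤c'
  where
    x<c : suc x ≤ _
    x<c = proj₁ (eastHeight-column p (suc x) y (trans (sym (eastHeight-skip y p x≢c)) e))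
    x≢c' : x ≢ _
    x≢c' = <⇒≢ (<-≤-trans x<c c≤c')

inner-tail : ∀ {pt} q s ps → pt ∈ innerPts (move s q) ps → pt ∈ innerPts q (s ∷ ps)
inner-tail q s []       ()
inner-tail q s (t ∷ ps) m = there m

eastStepEnd-inner : ∀ p x y {c t} → eastHeight (x , y) p c ≡ just t → suc c < x + countE p →
  (suc c , t) ∈ innerPts (x , y) p
eastStepEnd-inner []      x y () _
eastStepEnd-inner (N ∷ p) x y e c<end = inner-tail (x , y) N p (eastStepEnd-inner p x (suc y) e c<end)
eastStepEnd-inner (E ∷ p) x y {c} e c<end with x ≟ c
eastStepEnd-inner (E ∷ p) x y {c} e c<end | no x≢c =
  inner-tail (x , y) E p (eastStepEnd-inner p (suc x) y (trans (sym (eastHeight-skip y p x≢c)) e)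
                                             (subst (suc c <_) (+-suc x (countE p)) c<end))
eastStepEnd-inner (E ∷ p) x y e c<end | yes refl with just-injective (trans (sym (eastHeight-here x y p)) e) | p
... | refl | []     = ⊥-elim (<-irrefl (+-comm 1 x) c<end)
... | refl | s ∷ ps = here refl

northSegment-inner : ∀ p s q {x y y'' b} → move s q ≡ (x , y) → eastHeight (x , y) p x ≡ just b →
  y ≤ y'' → y'' ≤ b → (x , y'') ∈ innerPts q (s ∷ p)
northSegment-inner []      s q mv () _ _
northSegment-inner (N ∷ p) s q {x} {y} {y''} mv e y≤y'' y''≤b with m≤n⇒m<n∨m≡n y≤y''
... | inj₂ refl = here (sym mv)
... | inj₁ y<y'' = inner-tail q s (N ∷ p) (subst (λ r → (x , y'') ∈ innerPts r (N ∷ p)) (sym mv)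
                     (northSegment-inner p N (x , y) refl e y<y'' y''≤b))
northSegment-inner (E ∷ p) s q {x} {y} mv e y≤y'' y''≤b
  with just-injective (trans (sym (eastHeight-here x y p)) e)
... | refl with ≤-antisym y≤y'' y''≤b
...   | refl = here (sym mv)

climb-inner : ∀ p x y {c b b' y''} → eastHeight (x , y) p c ≡ just b → eastHeight (x , y) p (suc c) ≡ just b' →
  b ≤ y'' → y'' ≤ b' → (suc c , y'') ∈ innerPts (x , y) p
climb-inner []      x y () _ _ _
climb-inner (N ∷ p) x y e e' b≤y'' y''≤b' = inner-tail (x , y) N p (climb-inner p x (suc y) e e' b≤y'' y''≤b')
climb-inner (E ∷ p) x y {c} e e' b≤y'' y''≤b' with x ≟ c
... | yes refl with just-injective (trans (sym (eastHeight-here x y p)) e)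
...   | refl = northSegment-inner p E (x , y) refl (trans (sym (eastHeight-skip y p (<⇒≢ (n<1+n x)))) e')
                                b≤y'' y''≤b'
climb-inner (E ∷ p) x y e e' b≤y'' y''≤b' | no x≢c =
  inner-tail (x , y) E p (climb-inner p (suc x) y e₁ (trans (sym (eastHeight-skip y p x≢1+c)) e') b≤y'' y''≤b')
  where
    e₁ : eastHeight (suc x , y) p _ ≡ just _
    e₁ = trans (sym (eastHeight-skip y p x≢c)) e
    x≢1+c : x ≢ suc _
    x≢1+c = <⇒≢ (m<n⇒m<1+n (proj₁ (eastHeight-column p (suc x) y e₁)))

≡⇒within-two : ∀ {a b} → a ≡ b → b ≤ a × a ≤ b + 2
≡⇒within-two refl = ≤-refl , m≤m+n _ 2

shift-by-two : ∀ {a b} → a ≤ b × b ≤ a + 2 → b ≤ 2 + a × 2 + a ≤ b + 2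
shift-by-two {a} {b} (a≤b , b≤a+2) =
  subst (b ≤_) (+-comm a 2) b≤a+2 , subst (_≤ b + 2) (+-comm a 2) (+-monoˡ-≤ 2 a≤b)

within-one : ∀ {a b} → b ≤ a × a ≤ b + 2 → a ≤ suc b + 1 × suc b ≤ a + 1
within-one {a} {b} (b≤a , a≤b+2) = subst (a ≤_) (+-suc b 1) a≤b+2 , subst (suc b ≤_) (+-comm 1 a) (s≤s b≤a)

≡⇒within-one : ∀ {p q : List Step} → p ≡ q → changes p ≤ changes q + 1 × changes q ≤ changes p + 1
≡⇒within-one refl = m≤m+n _ 1 , m≤m+n _ 1

module Staircase
  (mem : ℕ → ℕ → Bool) (w H : ℕ) (bot top : ℕ → ℕ)
  (sound : ∀ {x y} → mem x y ≡ true → x < w × bot x ≤ y × y < top x)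
  (complete : ∀ {x y} → x < w → bot x ≤ y → y < top x → mem x y ≡ true)
  (bot-mono : ∀ {x x'} → x ≤ x' → x' < w → bot x ≤ bot x')
  (top-mono : ∀ {x x'} → x ≤ x' → x' < w → top x ≤ top x')
  (columns-overlap : ∀ {x} → suc x < w → bot (suc x) < top x)
  (top≤H : ∀ {x} → x < w → top x ≤ H)
  where

  -- Changes of direction of the greedy path from (x , y) with current direction d,
  -- including a change at the start when its first step is not d.
  turns : ℕ → Step → ℕ → ℕ → ℕ
  turns k d x y = changes (d ∷ greedy mem k d x y)

  -- Fuel that suffices from (x , y): every step increases x + y and every cell has x < w and
  -- y < H, so fewer than fuel x y steps remain.
  fuel : ℕ → ℕ → ℕ
  fuel x y = (w + H) ∸ suc (x + y)

  fuel-east : ∀ x y {k} → fuel x y ≤ suc k → fuel (suc x) y ≤ k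
  fuel-east x y {k} le = subst (_≤ k) (pred[m∸n]≡m∸[1+n] (w + H) (suc (x + y))) (pred-mono-≤ le)

  fuel-north : ∀ x y {k} → fuel x y ≤ suc k → fuel x (suc y) ≤ k
  fuel-north x y le rewrite +-suc x y = fuel-east x y le

  out-of-fuel : ∀ {x y} → mem x y ≡ true → ¬ fuel x y ≤ 0
  out-of-fuel {x} {y} m with sound m
  ... | x<w , _ , y<top = <⇒≱ (m<n⇒0<n∸m x+y<w+H-1)
    where
      x+y<w+H-1 : suc (x + y) < w + H
      x+y<w+H-1 = subst (_≤ w + H) (+-suc (suc x) y) (+-mono-≤ x<w (≤-trans y<top (top≤H x<w)))

  absent-outside : ∀ {x y} → mem x y ≡ false → x < w → bot x ≤ y → ¬ y < top x
  absent-outside e x<w b≤y y<t with trans (sym (complete x<w b≤y y<t)) e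
  ... | ()

  turn-north : ∀ k {x y} → mem (suc x) y ≡ false → mem x (suc y) ≡ true →
    turns (suc k) E x y ≡ suc (turns k N x (suc y))
  turn-north k e f rewrite e | f = refl

  turn-east : ∀ k {x y} → mem x (suc y) ≡ false → mem (suc x) y ≡ true →
    turns (suc k) N x y ≡ suc (turns k E (suc x) y)
  turn-east k e f rewrite e | f = refl

  stop : ∀ k {x y} → mem x (suc y) ≡ false → mem (suc x) y ≡ false → turns (suc k) N x y ≡ 0
  stop k e f rewrite e | f = refl

  turns-fuel-irrelevant : ∀ d k k' {x y} → mem x y ≡ true → fuel x y ≤ k → fuel x y ≤ k' →
    turns k d x y ≡ turns k' d x y
  turns-fuel-irrelevant d zero    k'       m f f' = ⊥-elim (out-of-fuel m f)
  turns-fuel-irrelevant d (suc k) zero     m f f' = ⊥-elim (out-of-fuel m f')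
  turns-fuel-irrelevant E (suc k) (suc k') {x} {y} m f f' with mem (suc x) y in e₁
  ... | true = turns-fuel-irrelevant E k k' e₁ (fuel-east x y f) (fuel-east x y f')
  ... | false with mem x (suc y) in e₂
  ...   | true  = cong suc (turns-fuel-irrelevant N k k' e₂ (fuel-north x y f) (fuel-north x y f'))
  ...   | false = refl
  turns-fuel-irrelevant N (suc k) (suc k') {x} {y} m f f' with mem x (suc y) in e₁
  ... | true = turns-fuel-irrelevant N k k' e₁ (fuel-north x y f) (fuel-north x y f')
  ... | false with mem (suc x) y in e₂
  ...   | true  = cong suc (turns-fuel-irrelevant E k k' e₂ (fuel-east x y f) (fuel-east x y f'))
  ...   | false = refl

  greedy-rowEnd : ∀ k {x y} → mem (suc x) y ≡ false →
    greedy mem (suc k) E x y ≡ (if mem x (suc y) then N ∷ greedy mem k N x (suc y) else [])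
  greedy-rowEnd k e rewrite e = refl

  greedy-columnTop : ∀ k {x y} → mem x (suc y) ≡ false →
    greedy mem (suc k) N x y ≡ (if mem (suc x) y then E ∷ greedy mem k E (suc x) y else [])
  greedy-columnTop k e rewrite e = refl

  eastRun : ∀ k x y → mem x y ≡ true → fuel x y ≤ k →
    Σ ℕ λ c → Σ ℕ λ k₁ → mem c y ≡ true × mem (suc c) y ≡ false × fuel c y ≤ k₁ ×
      turns k E x y ≡ turns k₁ E c y
  eastRun zero    x y m f = ⊥-elim (out-of-fuel m f)
  eastRun (suc k) x y m f with mem (suc x) y in e
  ... | true  = eastRun k (suc x) y e (fuel-east x y f)
  ... | false = x , suc k , m , e , f , cong (λ g → changes (E ∷ g)) (sym (greedy-rowEnd k e))

  northRun : ∀ k x y → mem x y ≡ true → fuel x y ≤ k →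
    Σ ℕ λ y₁ → Σ ℕ λ k₁ → mem x y₁ ≡ true × mem x (suc y₁) ≡ false × fuel x y₁ ≤ k₁ ×
      turns k N x y ≡ turns k₁ N x y₁
  northRun zero    x y m f = ⊥-elim (out-of-fuel m f)
  northRun (suc k) x y m f with mem x (suc y) in e
  ... | true  = northRun k x (suc y) e (fuel-north x y f)
  ... | false = y , suc k , m , e , f , cong (λ g → changes (N ∷ g)) (sym (greedy-columnTop k e))

  cell-below : ∀ {x y} → mem x (suc y) ≡ true → bot x ≤ y → mem x y ≡ true
  cell-below m b≤y with sound m
  ... | x<w , _ , y<t = complete x<w b≤y (<-trans (n<1+n _) y<t)

  top-of-column : ∀ {x y₁} → mem x y₁ ≡ true → mem x (suc y₁) ≡ false → top x ≡ suc y₁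
  top-of-column {x} {y₁} m m' with sound m
  ... | x<w , b≤y₁ , y₁<t = ≤-antisym (≮⇒≥ (absent-outside m' x<w (m≤n⇒m≤1+n b≤y₁))) y₁<t

  -- If row y ends at column c, then every column whose bottom is at most y lies weakly left of c:
  -- otherwise, by monotonicity, column c + 1 would contain the cell (c + 1 , y).
  rowEnd-bounds : ∀ {c y z} → mem c y ≡ true → mem (suc c) y ≡ false → z < w → bot z ≤ y → z ≤ c
  rowEnd-bounds {c} {y} {z} m m' z<w b≤y with z ≤? c
  ... | yes z≤c = z≤c
  ... | no z≰c with sound m
  ...   | c<w , _ , y<t = ⊥-elim (absent-outside m' 1+c<w (≤-trans (bot-mono c<z z<w) b≤y)
                                                    (<-≤-trans y<t (top-mono (n≤1+n c) 1+c<w)))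
    where
      c<z : suc c ≤ z
      c<z = ≰⇒> z≰c
      1+c<w : suc c < w
      1+c<w = <-≤-trans (s≤s c<z) z<w

  -- Cells in the same row have east-greedy paths with the same number of turns: they meet at the row end.
  turns-sameRow : ∀ {x x' y k k'} → mem x y ≡ true → mem x' y ≡ true → fuel x y ≤ k → fuel x' y ≤ k' →
    turns k E x y ≡ turns k' E x' y
  turns-sameRow {x} {x'} {y} {k} {k'} m m' f f' with eastRun k x y m f | eastRun k' x' y m' f'
  ... | c , k₁ , mc , mc' , fc , e | c' , k₁' , mc'' , mc''' , fc' , e' with sound mc | sound mc''
  ...   | c<w , bc , _ | c'<w , bc' , _ with ≤-antisym (rowEnd-bounds mc mc' c'<w bc') (rowEnd-bounds mc'' mc''' c<w bc)
  ...     | refl = trans e (trans (turns-fuel-irrelevant E k₁ k₁' mc fc fc') (sym e'))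

  beyond-last : ∀ {c y} → ¬ suc c < w → mem (suc c) y ≡ false
  beyond-last {c} {y} last with mem (suc c) y in r
  ... | true  = ⊥-elim (last (proj₁ (sound r)))
  ... | false = refl

  climb-lastColumn : ∀ k c y → mem c y ≡ true → fuel c y ≤ k → ¬ suc c < w → turns k N c y ≡ 0
  climb-lastColumn k c y m f last with northRun k c y m f
  ... | y₁ , zero  , m₁ , m₁' , f₁ , e = ⊥-elim (out-of-fuel m₁ f₁)
  ... | y₁ , suc k₁ , m₁ , m₁' , f₁ , e = trans e (stop k₁ m₁' (beyond-last last))

  turns≤1-inLastColumn : ∀ k c y → mem c y ≡ true → fuel c y ≤ k → ¬ suc c < w → turns k E c y ≤ 1
  turns≤1-inLastColumn zero    c y m f last = ⊥-elim (out-of-fuel m f)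
  turns≤1-inLastColumn (suc k) c y m f last rewrite beyond-last {c} {y} last with mem c (suc y) in e
  ... | true  = ≤-reflexive (cong suc (climb-lastColumn k c (suc y) e (fuel-north c y f) last))
  ... | false = z≤n

  -- In any other column the north-greedy path climbs to the top cell (c , y₁) and turns east;
  -- the cell (c + 1 , y₁) is present because consecutive columns overlap.
  climb : ∀ k c y → mem c y ≡ true → fuel c y ≤ k → suc c < w →
    Σ ℕ λ y₁ → Σ ℕ λ k₁ → top c ≡ suc y₁ × mem (suc c) y₁ ≡ true × fuel (suc c) y₁ ≤ k₁ ×
      turns k N c y ≡ suc (turns k₁ E (suc c) y₁)
  climb k c y m f 1+c<w with northRun k c y m f
  ... | y₁ , zero   , m₁ , m₁' , f₁ , e = ⊥-elim (out-of-fuel m₁ f₁)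
  ... | y₁ , suc k₁ , m₁ , m₁' , f₁ , e =
    y₁ , k₁ , top≡ , right , fuel-east c y₁ f₁ , trans e (turn-east k₁ m₁' right)
    where
      top≡ : top c ≡ suc y₁
      top≡ = top-of-column m₁ m₁'
      right : mem (suc c) y₁ ≡ true
      right = complete 1+c<w (s≤s⁻¹ (subst (bot (suc c) <_) top≡ (columns-overlap 1+c<w)))
                            (<-≤-trans (≤-reflexive (sym top≡)) (top-mono (n≤1+n c) 1+c<w))

  above-rowEnd : ∀ {c y y' z} → mem c y ≡ true → mem (suc c) y ≡ false → z < w → bot z ≤ y →
    y < y' → y' < top z → mem c (suc y) ≡ true
  above-rowEnd mc mc' z<w bz y<y' y'<tz with sound mc
  ... | c<w , bc , _ =
    complete c<w (m≤n⇒m≤1+n bc) (≤-<-trans y<y' (<-≤-trans y'<tz (top-mono (rowEnd-bounds mc mc' z<w bz) c<w)))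

  turns≤1-reachingLastColumn : ∀ k {c x y} → c < w → ¬ suc c < w → bot c ≤ y → mem x y ≡ true → fuel x y ≤ k →
    turns k E x y ≤ 1
  turns≤1-reachingLastColumn k {c} {x} {y} c<w last bc m f with eastRun k x y m f
  ... | c' , k₁ , mc' , mc'' , fc' , e =
    subst (_≤ 1) (sym e) (turns≤1-inLastColumn k₁ c' y mc' fc' c'-last)
    where
      c'-last : ¬ suc c' < w
      c'-last 1+c'<w = last (≤-<-trans (s≤s (rowEnd-bounds mc' mc'' c<w bc)) 1+c'<w)

  -- If y = y' the two paths merge. Otherwise the lower path runs to the end c ≥ z
  -- of its row and climbs column c: in the last column it stops after one turn, while the upper
  -- path turns at most once; else it turns east into (c + 1 , y₁) with y' ≤ y₁ after two turns,
  -- and we recurse with the roles of the two cells exchanged and column c as the common column.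
  -- The induction is on the room n left above the lower row (H ≤ n + y).
  turns-compare : ∀ n {x y x' y' k k'} z → H ≤ n + y → mem x y ≡ true → mem x' y' ≡ true → y ≤ y' →
    z < w → bot z ≤ y → y' < top z → fuel x y ≤ k → fuel x' y' ≤ k' →
    turns k' E x' y' ≤ turns k E x y × turns k E x y ≤ turns k' E x' y' + 2
  turns-compare n z H≤ m m' y≤y' z<w bz y'<tz f f' with m≤n⇒m<n∨m≡n y≤y'
  ... | inj₂ refl = ≡⇒within-two (turns-sameRow m m' f f')
  turns-compare zero z H≤ m m' y≤y' z<w bz y'<tz f f' | inj₁ y<y' =
    ⊥-elim (<-irrefl refl (≤-<-trans H≤ (<-trans y<y' (<-≤-trans y'<tz (top≤H z<w)))))
  turns-compare (suc n) {x} {y} {x'} {y'} {k} {k'} z H≤ m m' y≤y' z<w bz y'<tz f f' | inj₁ y<y'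
    with eastRun k x y m f
  ... | c , zero , mc , mc' , fc , e = ⊥-elim (out-of-fuel mc fc)
  ... | c , suc k₁ , mc , mc' , fc , e with sound mc | above-rowEnd mc mc' z<w bz y<y' y'<tz | suc c <? w
  ...   | c<w , bc , _ | up | no last =
    subst (turns k' E x' y' ≤_) (sym lower≡1) (turns≤1-reachingLastColumn k' c<w last (≤-trans bc y≤y') m' f') ,
    subst (_≤ turns k' E x' y' + 2) (sym lower≡1) (≤-trans (n≤1+n 1) (m≤n+m 2 _))
    where
      lower≡1 : turns k E x y ≡ 1
      lower≡1 = trans e (trans (turn-north k₁ mc' up)
                               (cong suc (climb-lastColumn k₁ c (suc y) up (fuel-north c y fc) last)))
  ...   | c<w , bc , _ | up | yes 1+c<w with climb k₁ c (suc y) up (fuel-north c y fc) 1+c<w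
  ...     | y₁ , k₂ , top≡ , right , f₂ , e₂ =
    subst (λ t → turns k' E x' y' ≤ t × t ≤ turns k' E x' y' + 2) (sym lower≡)
      (shift-by-two (turns-compare n c H≤' m' right y'≤y₁ c<w (≤-trans bc y≤y') y₁<top f' f₂))
    where
      lower≡ : turns k E x y ≡ 2 + turns k₂ E (suc c) y₁
      lower≡ = trans e (trans (turn-north k₁ mc' up) (cong suc e₂))
      y₁<top : y₁ < top c
      y₁<top = ≤-reflexive (sym top≡)
      y'≤y₁ : y' ≤ y₁
      y'≤y₁ = s≤s⁻¹ (subst (y' <_) top≡ (<-≤-trans y'<tz (top-mono (rowEnd-bounds mc mc' z<w bz) c<w)))
      H≤' : H ≤ n + y'
      H≤' = ≤-trans H≤ (subst (_≤ n + y') (+-suc n y) (+-monoʳ-≤ n y<y'))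

  greedy-blockedEast : ∀ K {x y} → mem (suc x) y ≡ false → greedy mem K E x y ≡ greedy mem K N x y
  greedy-blockedEast zero    e = refl
  greedy-blockedEast (suc K) {x} {y} e rewrite e with mem x (suc y)
  ... | true  = refl
  ... | false = refl

  greedy-blockedNorth : ∀ K {x y} → mem x (suc y) ≡ false → greedy mem K E x y ≡ greedy mem K N x y
  greedy-blockedNorth zero    e = refl
  greedy-blockedNorth (suc K) {x} {y} e rewrite e with mem (suc x) y
  ... | true  = refl
  ... | false = refl

  changes-startEast : ∀ K {x y} → mem (suc x) y ≡ true → changes (greedy mem K E x y) ≡ turns K E x y
  changes-startEast zero    e = refl
  changes-startEast (suc K) e rewrite e = refl

  changes-startNorth : ∀ K {x y} → mem x (suc y) ≡ true → changes (greedy mem K N x y) ≡ turns K N x y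
  changes-startNorth zero    e = refl
  changes-startNorth (suc K) e rewrite e = refl

  -- The north path climbs column 0 and turns east
  -- into (1 , y₁); the key comparison of (0 , 0) with (1 , y₁) (both in column 0) does the rest.
  greedy-changes-close : ∀ K → fuel 0 0 ≤ K → bot 0 ≡ 0 →
    changes (greedy mem K E 0 0) ≤ changes (greedy mem K N 0 0) + 1 ×
    changes (greedy mem K N 0 0) ≤ changes (greedy mem K E 0 0) + 1
  greedy-changes-close K f bot0 with mem 1 0 in right | mem 0 1 in up
  ... | false | _     = ≡⇒within-one (greedy-blockedEast K right)
  ... | true  | false = ≡⇒within-one (greedy-blockedNorth K up)
  ... | true  | true with cell-below up (≤-reflexive bot0) | proj₁ (sound right)
  ...   | origin | 1<w with climb K 0 0 origin f 1<w
  ...     | y₁ , k₁ , top≡ , m₁ , f₁ , north≡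
    rewrite changes-startEast K right | changes-startNorth K up | north≡ =
    within-one (turns-compare H 0 (m≤m+n H 0) origin m₁ z≤n (<-trans (s≤s z≤n) 1<w) (≤-reflexive bot0)
                              (≤-reflexive (sym top≡)) f f₁)

module Columns (U L : Path) (pp : IsParallelogram U L) where
  open IsParallelogram pp

  width height : ℕ
  width  = countE U
  height = countN U

  bottom top : ℕ → ℕ
  bottom x = fromMaybe 0 (eastHeight (0 , 0) L x)
  top    x = fromMaybe 0 (eastHeight (0 , 0) U x)

  upper-step : ∀ {x} → x < width → ∃ λ t → eastHeight (0 , 0) U x ≡ just t
  upper-step {x} x<w = eastHeight-defined U 0 0 x z≤n x<w

  lower-step : ∀ {x} → x < width → ∃ λ b → eastHeight (0 , 0) L x ≡ just b
  lower-step {x} x<w = eastHeight-defined L 0 0 x z≤n (subst (x <_) sameE x<w)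

  inP-sound : ∀ {x y} → inP U L x y ≡ true → x < width × bottom x ≤ y × y < top x
  inP-sound {x} {y} e with eastHeight (0 , 0) L x in eL | eastHeight (0 , 0) U x in eU
  inP-sound () | nothing | _
  inP-sound () | just b  | nothing
  inP-sound {x} {y} e | just b | just t with Equivalence.to T-∧ (≡true⇒T e)
  ... | b≤y , y<t = proj₂ (eastHeight-column U 0 0 eU) , ≤ᵇ⇒≤ b y b≤y , <ᵇ⇒< y t y<t

  inP-complete : ∀ {x y} → x < width → bottom x ≤ y → y < top x → inP U L x y ≡ true
  inP-complete x<w b≤y y<t with lower-step x<w | upper-step x<w
  ... | b , eL | t , eU rewrite eL | eU = T⇒≡true (Equivalence.from T-∧ (≤⇒≤ᵇ b≤y , <⇒<ᵇ y<t))

  bottom-mono : ∀ {x x'} → x ≤ x' → x' < width → bottom x ≤ bottom x'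
  bottom-mono x≤x' x'<w with lower-step (≤-<-trans x≤x' x'<w) | lower-step x'<w
  ... | b , e | b' , e' rewrite e | e' = eastHeight-monotone L 0 0 e e' x≤x'

  top-mono : ∀ {x x'} → x ≤ x' → x' < width → top x ≤ top x'
  top-mono x≤x' x'<w with upper-step (≤-<-trans x≤x' x'<w) | upper-step x'<w
  ... | t , e | t' , e' rewrite e | e' = eastHeight-monotone U 0 0 e e' x≤x'

  top≤height : ∀ {x} → x < width → top x ≤ height
  top≤height x<w with upper-step x<w
  ... | t , e rewrite e = proj₂ (eastHeight-height U 0 0 e)

  -- L starts with an east step at height 0, U with a north step, so column 0 starts at 0 and is nonempty.
  bottom-zero : bottom 0 ≡ 0
  bottom-zero with lowerStart
  ... | p , refl = refl

  top-zero-positive : 0 < width → 0 < top 0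
  top-zero-positive 0<w with upperStart | upper-step 0<w
  ... | p , refl | t , e rewrite e = proj₁ (eastHeight-height p 0 1 e)

  -- The overlap is where the
  -- disjointness of U and L enters: if top x ≤ bottom (x + 1), the point (x + 1 , top x) would be
  -- an inner vertex of U (right end of its east step at column x) and of L (on its climb
  -- between the east steps at columns x and x + 1).
  column-nonempty : ∀ x → x < width → bottom x < top x
  columns-overlap : ∀ {x} → suc x < width → bottom (suc x) < top x

  column-nonempty zero    0<w   = subst (_< top 0) (sym bottom-zero) (top-zero-positive 0<w)
  column-nonempty (suc x) 1+x<w = <-≤-trans (columns-overlap 1+x<w) (top-mono (n≤1+n x) 1+x<w)

  columns-overlap {x} 1+x<w with bottom (suc x) <? top x
  ... | yes below = below
  ... | no ¬below with <-trans (n<1+n x) 1+x<w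
  ...   | x<w with upper-step x<w | lower-step x<w | lower-step 1+x<w
  ...     | t , eU | b , eL | b' , eL' =
    ⊥-elim (disjoint (suc x , t) (eastStepEnd-inner U 0 0 eU 1+x<w) (climb-inner L 0 0 eL eL' b≤t t≤b'))
    where
      b≤t : b ≤ t
      b≤t = <⇒≤ (subst₂ _<_ (cong (fromMaybe 0) eL) (cong (fromMaybe 0) eU) (column-nonempty x x<w))
      t≤b' : t ≤ b'
      t≤b' = subst₂ _≤_ (cong (fromMaybe 0) eU) (cong (fromMaybe 0) eL') (≮⇒≥ ¬below)

mainTheorem4 : ∀ (U L : Path) → IsParallelogram U L →
    (changes (hPath U L) ≤ changes (vPath U L) + 1) × (changes (vPath U L) ≤ changes (hPath U L) + 1)
mainTheorem4 U L pp =
  greedy-changes-close (countE U + countN U) (m∸n≤m (countE U + countN U) 1) bottom-zero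
  where
    open Columns U L pp
    open Staircase (inP U L) width height bottom top
                   inP-sound inP-complete bottom-mono top-mono columns-overlap top≤height
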